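{- Let $\oplus: \mathrm{Ord}\times\mathrm{Ord}\to\mathrm{Ord}$ be a natural ordinal operation. If $\alpha, \beta, \gamma$ are ordinals and $\gamma$ is an instance of a sum of $\alpha$ and $\beta$, then $\gamma \leq \alpha \oplus \beta$.
   Context: A binary operation $\oplus$ on the ordinals is a natural ordinal operation if for all ordinals $\alpha,\beta,\gamma$: (1) $\alpha\oplus\beta=\beta\oplus\alpha$; (2) $(\alpha\oplus\beta)\oplus\gamma=\alpha\oplus(\beta\oplus\gamma)$; (3) $\alpha\oplus 0=\alpha$; (4) $\gamma\oplus\alpha>\gamma\oplus\beta$ iff $\alpha>\beta$. A linear order $C$ is an instance of a sum of linear orders $A$ and $B$ if $C$ is the union of two disjoint suborders $A', B'$ with $A'\cong A$ and $B'\cong B$. -}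

module Defs where

open import Level using (0ℓ)
open import Data.Bool using (Bool; true; false)
open import Data.Empty using (⊥)
open import Data.Product using (Σ; _×_; _,_; proj₁)
open import Relation.Binary.PropositionalEquality using (_≡_; _≢_)
open import Relation.Binary.Definitions using (Trichotomous; Transitive)
open import Induction.WellFounded using (WellFounded)
open import Function.Bundles using (_⇔_)
open import Axiom.ExcludedMiddle using (ExcludedMiddle)

record RawOrder : Set₁ where
  field
    Carrier : Set
    _<_     : Carrier → Carrier → Set

record Ordinal : Set₁ where
  field
    Carrier : Set
    _<_     : Carrier → Carrier → Set
    <-trans : Transitive _<_
    <-tri   : Trichotomous _≡_ _<_
    <-wf    : WellFounded _<_

  raw : RawOrder
  raw = record { Carrier = Carrier ; _<_ = _<_ }

open Ordinal

record _≅ʳ_ (A B : RawOrder) : Set where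
  private
    module A = RawOrder A
    module B = RawOrder B
  field
    to      : A.Carrier → B.Carrier
    from    : B.Carrier → A.Carrier
    from∘to : ∀ x → from (to x) ≡ x
    to∘from : ∀ y → to (from y) ≡ y
    to-mono   : ∀ {x y} → x A.< y → to x B.< to y
    from-mono : ∀ {x y} → x B.< y → from x A.< from y

_≅_ : Ordinal → Ordinal → Set
α ≅ β = raw α ≅ʳ raw β

-- α ≤ β : α is isomorphic to an initial segment of β (a simulation).
record _≤ₒ_ (α β : Ordinal) : Set where
  field
    fun  : Carrier α → Carrier β
    mono : ∀ {x y} → _<_ α x y → _<_ β (fun x) (fun y)
    init : ∀ {a b} → _<_ β b (fun a) → Σ (Carrier α) (λ a′ → fun a′ ≡ b)

_<ₒ_ : Ordinal → Ordinal → Set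
α <ₒ β = Σ (α ≤ₒ β) (λ s → Σ (Carrier β) (λ b → ∀ a → _≤ₒ_.fun s a ≢ b))

zeroₒ : Ordinal
zeroₒ = record
  { Carrier = ⊥ ; _<_ = λ () ; <-trans = λ {} ; <-tri = λ () ; <-wf = λ () }

-- Natural ordinal operation (conditions (1)-(4)); since Ord is represented by
-- well-order structures rather than isomorphism classes, equalities are up to
-- ≅ and the operation is required to be well defined on order types.
record NaturalOp (_⊕_ : Ordinal → Ordinal → Ordinal) : Set₁ where
  field
    resp  : ∀ {α α′ β β′} → α ≅ α′ → β ≅ β′ → (α ⊕ β) ≅ (α′ ⊕ β′)
    comm  : ∀ α β → (α ⊕ β) ≅ (β ⊕ α)
    assoc : ∀ α β γ → ((α ⊕ β) ⊕ γ) ≅ (α ⊕ (β ⊕ γ))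
    idʳ   : ∀ α → (α ⊕ zeroₒ) ≅ α
    mono  : ∀ α β γ → ((γ ⊕ β) <ₒ (γ ⊕ α)) ⇔ (β <ₒ α)

sub : (C : RawOrder) → (RawOrder.Carrier C → Set) → RawOrder
sub C P = record
  { Carrier = Σ (RawOrder.Carrier C) P
  ; _<_ = λ x y → RawOrder._<_ C (proj₁ x) (proj₁ y) }

-- C is an instance of a sum of A and B: C is the union of two disjoint
-- suborders A′, B′ (a partition p of C into two parts) with A′ ≅ A, B′ ≅ B.
IsSumInstance : RawOrder → RawOrder → RawOrder → Set
IsSumInstance C A B =
  Σ (RawOrder.Carrier C → Bool) λ p →
    (sub C (λ c → p c ≡ true) ≅ʳ A) × (sub C (λ c → p c ≡ false) ≅ʳ B)

{-# OPTIONS --safe #-}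
module Submission where

-- Let A and B be the two parts of γ, and for a lower set D of γ put D_A = D ∩ A,
-- D_B = D ∩ B. For c ∈ D, the sets (γ↓c)_A and (γ↓c)_B are initial segments of D_A
-- and D_B, and the one on the side of c is proper, so strict monotonicity of ⊕
-- gives (γ↓c)_A ⊕ (γ↓c)_B < D_A ⊕ D_B (the non-strict half uses that a simulation
-- is an isomorphism or a strict one, which is classical). By well-founded
-- induction γ↓c ≤ (γ↓c)_A ⊕ (γ↓c)_B, so every proper initial segment of D lies
-- below D_A ⊕ D_B; an ordinal all of whose proper initial segments lie below δ is
-- at most δ. Taking D = γ gives γ ≤ A ⊕ B.

open import Defs
open import Level using (0ℓ)
open import Axiom.ExcludedMiddle using (ExcludedMiddle)
open import Axiom.UniquenessOfIdentityProofs using (module Decidable⇒UIP)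
open import Data.Bool using (Bool; true; false; T; _∧_; not; _≟_)
open import Data.Bool.Properties using (T-∧; T-≡; T-not-≡; T-irrelevant)
open import Data.Product using (Σ; Σ-syntax; _×_; _,_; proj₁; proj₂)
open import Data.Sum using (_⊎_; inj₁; inj₂)
open import Data.Unit using (tt)
open import Function using (_∘_)
open import Function.Bundles using (_⇔_; Equivalence)
open import Induction.WellFounded using (Acc; acc)
open import Relation.Binary.Consequences using (tri⇒irr; tri⇒dec<)
open import Relation.Binary.Construct.On as On using ()
open import Relation.Binary.Definitions using (Trichotomous; tri<; tri≈; tri>)
open import Relation.Binary.PropositionalEquality using (_≡_; _≢_; refl; sym; trans; cong; subst; subst₂)
open import Relation.Nullary using (¬_; yes; no; contradiction)
open import Relation.Nullary.Decidable using (⌊_⌋; toWitness; fromWitness)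

_⊢_<_ : (X : Ordinal) → Ordinal.Carrier X → Ordinal.Carrier X → Set
X ⊢ x < y = Ordinal._<_ X x y

private variable
  A B C δ : Ordinal

Σ-≡ : {I : Set} {P : I → Set} → (∀ {i} (u v : P i) → u ≡ v) →
      {u v : Σ I P} → proj₁ u ≡ proj₁ v → u ≡ v
Σ-≡ irrelevant {i , u} {.i , v} refl = cong (i ,_) (irrelevant u v)

T-∧-fst : ∀ {a b} → T (a ∧ b) → T a
T-∧-fst = proj₁ ∘ Equivalence.to T-∧

T-∧-snd : ∀ {a b} → T (a ∧ b) → T b
T-∧-snd = proj₂ ∘ Equivalence.to T-∧

T-∧-intro : ∀ {a b} → T a → T b → T (a ∧ b)
T-∧-intro ta tb = Equivalence.from T-∧ (ta , tb)

_∩_ : {I : Set} → (I → Bool) → (I → Bool) → I → Bool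
(S ∩ S′) x = S x ∧ S′ x

T-or-T-not : ∀ b → T b ⊎ T (not b)
T-or-T-not true  = inj₁ tt
T-or-T-not false = inj₂ tt

module _ (X : Ordinal) where
  open Ordinal X

  <-irrefl : ∀ {x} → ¬ x < x
  <-irrefl = tri⇒irr <-tri refl

  <-extensional : ∀ {x y} → (∀ {z} → z < x → z < y) → (∀ {z} → z < y → z < x) → x ≡ y
  <-extensional {x} {y} x⊆y y⊆x with <-tri x y
  ... | tri< x<y _ _ = contradiction (y⊆x x<y) <-irrefl
  ... | tri≈ _ x≡y _ = x≡y
  ... | tri> _ _ y<x = contradiction (x⊆y y<x) <-irrefl

infix 30 _↾_

-- Subsets are Bool-valued so that membership proofs are irrelevant: this makes
-- the suborder trichotomous with respect to _≡_ on the Σ-type.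

_↾_ : (X : Ordinal) → (Ordinal.Carrier X → Bool) → Ordinal
X ↾ S = record
  { Carrier = Σ Carrier (T ∘ S)
  ; _<_     = λ x y → proj₁ x < proj₁ y
  ; <-trans = <-trans
  ; <-tri   = compare
  ; <-wf    = On.wellFounded proj₁ <-wf
  }
  where
  open Ordinal X
  compare : Trichotomous _≡_ (λ (x y : Σ Carrier (T ∘ S)) → proj₁ x < proj₁ y)
  compare (x , s) (y , t) with <-tri x y
  ... | tri< a ¬b ¬c = tri< a (¬b ∘ cong proj₁) ¬c
  ... | tri≈ ¬a b ¬c = tri≈ ¬a (Σ-≡ T-irrelevant b) ¬c
  ... | tri> ¬a ¬b c = tri> ¬a (¬b ∘ cong proj₁) c

below : (X : Ordinal) → Ordinal.Carrier X → Ordinal.Carrier X → Bool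
below X c y = ⌊ tri⇒dec< (Ordinal.<-tri X) y c ⌋

module _ (X : Ordinal) where
  open Ordinal X

  below⇒< : ∀ {c y} → T (below X c y) → y < c
  below⇒< = toWitness

  <⇒below : ∀ {c y} → y < c → T (below X c y)
  <⇒below = fromWitness

  IsLowerSet : (Carrier → Bool) → Set
  IsLowerSet D = ∀ {x y} → y < x → T (D x) → T (D y)

  below-isLowerSet : ∀ {c} → IsLowerSet (below X c)
  below-isLowerSet y<x x<c = <⇒below (<-trans y<x (below⇒< x<c))

  record InitialPart (S S′ : Carrier → Bool) : Set where
    field
      included : ∀ {x} → T (S x) → T (S′ x)
      closed   : ∀ {x y} → y < x → T (S′ y) → T (S x) → T (S y)

  lowerSet⇒InitialPart : ∀ {S S′} → IsLowerSet S → (∀ {x} → T (S x) → T (S′ x)) →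
                         InitialPart S S′
  lowerSet⇒InitialPart lower included = record
    { included = included ; closed = λ y<x _ → lower y<x }

  ∩-InitialPart : ∀ {S S′} (f : Carrier → Bool) → InitialPart S S′ → InitialPart (S ∩ f) (S′ ∩ f)
  ∩-InitialPart f I = record
    { included = λ s∧f → T-∧-intro (included (T-∧-fst s∧f)) (T-∧-snd s∧f)
    ; closed   = λ y<x s′∧f s∧f →
        T-∧-intro (closed y<x (T-∧-fst s′∧f) (T-∧-fst s∧f)) (T-∧-snd s′∧f)
    }
    where open InitialPart I

module _ (X : Ordinal) {S S′ : Ordinal.Carrier X → Bool} (I : InitialPart X S S′) where
  open InitialPart I

  InitialPart⇒≤ₒ : X ↾ S ≤ₒ X ↾ S′
  InitialPart⇒≤ₒ = record
    { fun  = λ (x , s) → x , included s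
    ; mono = λ x<y → x<y
    ; init = λ { {_ , s} {y , s′} y<x → (y , closed y<x s′ s) , Σ-≡ T-irrelevant refl }
    }

  InitialPart⇒<ₒ : ∀ {x} → T (S′ x) → ¬ T (S x) → X ↾ S <ₒ X ↾ S′
  InitialPart⇒<ₒ {x} s′ ¬s =
    InitialPart⇒≤ₒ , (x , s′) , λ (y , s) y≡x → ¬s (subst (T ∘ S) (cong proj₁ y≡x) s)

module _ (X : Ordinal) {D : Ordinal.Carrier X → Bool} (lower : IsLowerSet X D)
         {c : Ordinal.Carrier X} (dc : T (D c)) where

  below-InitialPart : InitialPart X (below X c) D
  below-InitialPart = lowerSet⇒InitialPart X (below-isLowerSet X) (λ y<c → lower (below⇒< X y<c) dc)

  below∩-≤ₒ : (f : Ordinal.Carrier X → Bool) → X ↾ (below X c ∩ f) ≤ₒ X ↾ (D ∩ f)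
  below∩-≤ₒ f = InitialPart⇒≤ₒ X (∩-InitialPart X f below-InitialPart)

  below∩-<ₒ : (f : Ordinal.Carrier X → Bool) → T (f c) → X ↾ (below X c ∩ f) <ₒ X ↾ (D ∩ f)
  below∩-<ₒ f fc = InitialPart⇒<ₒ X (∩-InitialPart X f below-InitialPart) (T-∧-intro dc fc)
                     (<-irrefl X ∘ below⇒< X ∘ T-∧-fst)

↾-true-≅ : (X : Ordinal) → X ≅ X ↾ (λ _ → true)
↾-true-≅ X = record
  { to = λ x → x , tt ; from = proj₁ ; from∘to = λ _ → refl ; to∘from = λ _ → refl
  ; to-mono = λ x<y → x<y ; from-mono = λ x<y → x<y }

↾≅sub : (X : Ordinal) {S : Ordinal.Carrier X → Bool} {P : Ordinal.Carrier X → Set} →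
        (∀ {x} → T (S x) ⇔ P x) → (∀ {x} (u v : P x) → u ≡ v) →
        Ordinal.raw (X ↾ S) ≅ʳ sub (Ordinal.raw X) P
↾≅sub X S⇔P P-irrelevant = record
  { to        = λ (x , s) → x , Equivalence.to S⇔P s
  ; from      = λ (x , px) → x , Equivalence.from S⇔P px
  ; from∘to   = λ _ → Σ-≡ T-irrelevant refl
  ; to∘from   = λ _ → Σ-≡ P-irrelevant refl
  ; to-mono   = λ x<y → x<y
  ; from-mono = λ x<y → x<y
  }

module Simulation {A B : Ordinal} (s : A ≤ₒ B) where
  open _≤ₒ_ s public

  reflects-< : ∀ {x y} → B ⊢ fun x < fun y → A ⊢ x < y
  reflects-< {x} {y} fx<fy with Ordinal.<-tri A x y
  ... | tri< x<y _ _ = x<y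
  ... | tri≈ _ refl _ = contradiction fx<fy (<-irrefl B)
  ... | tri> _ _ y<x = contradiction (Ordinal.<-trans B fx<fy (mono y<x)) (<-irrefl B)

  injective : ∀ {x y} → fun x ≡ fun y → x ≡ y
  injective {x} {y} fx≡fy with Ordinal.<-tri A x y
  ... | tri< x<y _ _ = contradiction (subst (B ⊢ fun x <_) (sym fx≡fy) (mono x<y)) (<-irrefl B)
  ... | tri≈ _ x≡y _ = x≡y
  ... | tri> _ _ y<x = contradiction (subst (B ⊢_< fun x) (sym fx≡fy) (mono y<x)) (<-irrefl B)

open Simulation using (reflects-<; injective)
open _≤ₒ_ using (fun; mono; init)

≤ₒ-trans : A ≤ₒ B → B ≤ₒ C → A ≤ₒ C
≤ₒ-trans {A = A} {C = C} s t = record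
  { fun  = fun t ∘ fun s
  ; mono = mono t ∘ mono s
  ; init = preimage
  }
  where
  preimage : ∀ {a c} → C ⊢ c < fun t (fun s a) → Σ[ a′ ∈ Ordinal.Carrier A ] fun t (fun s a′) ≡ c
  preimage c<tsa with init t c<tsa
  ... | _ , refl with init s (reflects-< t c<tsa)
  ...   | a′ , refl = a′ , refl

≤ₒ-<ₒ-trans : A ≤ₒ B → B <ₒ C → A <ₒ C
≤ₒ-<ₒ-trans s (t , c , c∉t) = ≤ₒ-trans s t , c , c∉t ∘ fun s

<ₒ-≤ₒ-trans : A <ₒ B → B ≤ₒ C → A <ₒ C
<ₒ-≤ₒ-trans (s , b , b∉s) t = ≤ₒ-trans s t , fun t b , λ a tsa≡tb → b∉s a (injective t tsa≡tb)

≅⇒≤ₒ : A ≅ B → A ≤ₒ B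
≅⇒≤ₒ i = record { fun = to ; mono = to-mono ; init = λ {_} {b} _ → from b , to∘from b }
  where open _≅ʳ_ i

≅ʳ-refl : {P : RawOrder} → P ≅ʳ P
≅ʳ-refl = record
  { to = λ x → x ; from = λ x → x ; from∘to = λ _ → refl ; to∘from = λ _ → refl
  ; to-mono = λ x<y → x<y ; from-mono = λ x<y → x<y }

≅ʳ-trans : {P Q R : RawOrder} → P ≅ʳ Q → Q ≅ʳ R → P ≅ʳ R
≅ʳ-trans i j = record
  { to        = J.to ∘ I.to
  ; from      = I.from ∘ J.from
  ; from∘to   = λ x → trans (cong I.from (J.from∘to (I.to x))) (I.from∘to x)
  ; to∘from   = λ z → trans (cong J.to (I.to∘from (J.from z))) (J.to∘from z)
  ; to-mono   = J.to-mono ∘ I.to-mono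
  ; from-mono = I.from-mono ∘ J.from-mono
  }
  where
  module I = _≅ʳ_ i
  module J = _≅ʳ_ j

simulation-unique : (s t : A ≤ₒ B) → ∀ a → fun s a ≡ fun t a
simulation-unique {A} {B} s t a = go a (Ordinal.<-wf A a)
  where
  go : ∀ a → Acc (Ordinal._<_ A) a → fun s a ≡ fun t a
  go a (acc rec) = <-extensional B (below-shift s t ih) (below-shift t s (sym ∘ ih))
    where
    ih : ∀ {a′} → A ⊢ a′ < a → fun s a′ ≡ fun t a′
    ih a′<a = go _ (rec a′<a)

    below-shift : (u v : A ≤ₒ B) → (∀ {a′} → A ⊢ a′ < a → fun u a′ ≡ fun v a′) →
                  ∀ {b} → B ⊢ b < fun u a → B ⊢ b < fun v a
    below-shift u v u≡v b<ua with init u b<ua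
    ... | a′ , refl = subst (B ⊢_< fun v a) (sym (u≡v a′<a)) (mono v a′<a)
      where
      a′<a : A ⊢ a′ < a
      a′<a = reflects-< u b<ua

surjective⇒≅ : (s : A ≤ₒ B) → (∀ b → Σ[ a ∈ Ordinal.Carrier A ] fun s a ≡ b) → A ≅ B
surjective⇒≅ {B = B} s preimage = record
  { to        = fun s
  ; from      = proj₁ ∘ preimage
  ; from∘to   = λ a → injective s (proj₂ (preimage (fun s a)))
  ; to∘from   = proj₂ ∘ preimage
  ; to-mono   = mono s
  ; from-mono = λ {x} {y} x<y →
      reflects-< s (subst₂ (Ordinal._<_ B) (sym (proj₂ (preimage x))) (sym (proj₂ (preimage y))) x<y)
  }

record ImageIsBelow {A B : Ordinal} (s : A ≤ₒ B) (m : Ordinal.Carrier B) : Set where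
  field
    image-< : ∀ a → B ⊢ fun s a < m
    <-image : ∀ {b} → B ⊢ b < m → Σ[ a ∈ Ordinal.Carrier A ] fun s a ≡ b

module _ (em : ExcludedMiddle 0ℓ) where

  least : (X : Ordinal) (P : Ordinal.Carrier X → Set) → ∀ {x} → P x →
          Σ[ m ∈ Ordinal.Carrier X ] P m × (∀ {y} → X ⊢ y < m → ¬ P y)
  least X P {x} px = go x (Ordinal.<-wf X x) px
    where
    go : ∀ x → Acc (Ordinal._<_ X) x → P x →
         Σ[ m ∈ Ordinal.Carrier X ] P m × (∀ {y} → X ⊢ y < m → ¬ P y)
    go x (acc rec) px with em {Σ[ y ∈ Ordinal.Carrier X ] X ⊢ y < x × P y}
    ... | yes (y , y<x , py) = go y (rec y<x) py
    ... | no ∄y             = x , px , λ y<x py → ∄y (_ , y<x , py)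

  ≤ₒ⇒≅⊎<ₒ : A ≤ₒ B → A ≅ B ⊎ A <ₒ B
  ≤ₒ⇒≅⊎<ₒ {A} {B} s with em {Σ[ b ∈ Ordinal.Carrier B ] (∀ a → fun s a ≢ b)}
  ... | yes missed = inj₂ (s , missed)
  ... | no ∄missed = inj₁ (surjective⇒≅ s preimage)
    where
    preimage : ∀ b → Σ[ a ∈ Ordinal.Carrier A ] fun s a ≡ b
    preimage b with em {Σ[ a ∈ Ordinal.Carrier A ] fun s a ≡ b}
    ... | yes a = a
    ... | no ∄a = contradiction (b , λ a sa≡b → ∄a (a , sa≡b)) ∄missed

  <ₒ⇒ImageIsBelow : ((s , _) : A <ₒ B) → Σ[ m ∈ Ordinal.Carrier B ] ImageIsBelow s m
  <ₒ⇒ImageIsBelow {A} {B} (s , b , b∉s) with least B (λ b → ∀ a → fun s a ≢ b) b∉s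
  ... | m , m∉s , below-m-hit = m , record { image-< = image-< ; <-image = <-image }
    where
    image-< : ∀ a → B ⊢ fun s a < m
    image-< a with Ordinal.<-tri B (fun s a) m
    ... | tri< sa<m _ _ = sa<m
    ... | tri≈ _ sa≡m _ = contradiction sa≡m (m∉s a)
    ... | tri> _ _ m<sa = let a′ , sa′≡m = init s m<sa in contradiction sa′≡m (m∉s a′)

    <-image : ∀ {b} → B ⊢ b < m → Σ[ a ∈ Ordinal.Carrier A ] fun s a ≡ b
    <-image {b} b<m with em {Σ[ a ∈ Ordinal.Carrier A ] fun s a ≡ b}
    ... | yes a = a
    ... | no ∄a = contradiction (λ a sa≡b → ∄a (a , sa≡b)) (below-m-hit b<m)

  -- Each c ∈ D is sent to the least element of δ missed by the simulation of X ↾ below X c;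
  -- by uniqueness of simulations these choices are coherent along D.
  segments-<ₒ⇒≤ₒ : (X : Ordinal) {D : Ordinal.Carrier X → Bool} → IsLowerSet X D →
                   (∀ {c} → T (D c) → X ↾ below X c <ₒ δ) → X ↾ D ≤ₒ δ
  segments-<ₒ⇒≤ₒ {δ} X {D} lower segment-< = record
    { fun  = λ (_ , dc) → m dc
    ; mono = λ { {_ , dz} {_ , dc} z<c →
        subst (δ ⊢_< m dc) (sym (m-coherent dz dc z<c)) (image-< (bound dc) _) }
    ; init = λ { {_ , dc} b<m → preimage dc b<m }
    }
    where
    open Ordinal X
    open ImageIsBelow

    s : ∀ {c} → T (D c) → X ↾ below X c ≤ₒ δ
    s dc = proj₁ (segment-< dc)

    m : ∀ {c} → T (D c) → Ordinal.Carrier δ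
    m dc = proj₁ (<ₒ⇒ImageIsBelow (segment-< dc))

    bound : ∀ {c} (dc : T (D c)) → ImageIsBelow (s dc) (m dc)
    bound dc = proj₂ (<ₒ⇒ImageIsBelow (segment-< dc))

    inclusion : ∀ {z c} → z < c → X ↾ below X z ≤ₒ X ↾ below X c
    inclusion z<c = InitialPart⇒≤ₒ X (below-InitialPart X (below-isLowerSet X) (<⇒below X z<c))

    m-coherent : ∀ {z c} (dz : T (D z)) (dc : T (D c)) (z<c : z < c) →
                 m dz ≡ fun (s dc) (z , <⇒below X z<c)
    m-coherent {z} dz dc z<c = <-extensional δ below-m below-s
      where
      s-restricts : ∀ w → fun (s dz) w ≡ fun (s dc) (fun (inclusion z<c) w)
      s-restricts = simulation-unique (s dz) (≤ₒ-trans (inclusion z<c) (s dc))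

      sz : Ordinal.Carrier δ
      sz = fun (s dc) (z , <⇒below X z<c)

      below-m : ∀ {b} → δ ⊢ b < m dz → δ ⊢ b < sz
      below-m b<m with <-image (bound dz) b<m
      ... | w , refl = subst (δ ⊢_< sz) (sym (s-restricts w)) (mono (s dc) (below⇒< X (proj₂ w)))

      below-s : ∀ {b} → δ ⊢ b < sz → δ ⊢ b < m dz
      below-s b<sz with init (s dc) b<sz
      ... | (y , y<c) , refl = subst (δ ⊢_< m dz) sw≡sy (image-< (bound dz) w)
        where
        w : Ordinal.Carrier (X ↾ below X z)
        w = y , <⇒below X (reflects-< (s dc) b<sz)

        sw≡sy : fun (s dz) w ≡ fun (s dc) (y , y<c)
        sw≡sy = trans (s-restricts w) (cong (fun (s dc)) (Σ-≡ T-irrelevant refl))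

    preimage : ∀ {c b} (dc : T (D c)) → δ ⊢ b < m dc → Σ[ (z , dz) ∈ Σ Carrier (T ∘ D) ] m dz ≡ b
    preimage dc b<m with <-image (bound dc) b<m
    ... | (z , z<c) , refl = (z , lower (below⇒< X z<c) dc) ,
      trans (m-coherent _ dc (below⇒< X z<c)) (cong (fun (s dc)) (Σ-≡ T-irrelevant refl))

  module _ {_⊕_ : Ordinal → Ordinal → Ordinal} (N : NaturalOp _⊕_) where
    open NaturalOp N using (resp; comm) renaming (mono to monoʳ-<ₒ-⇔)

    ⊕-monoʳ-<ₒ : ∀ {A B B′} → B′ <ₒ B → (A ⊕ B′) <ₒ (A ⊕ B)
    ⊕-monoʳ-<ₒ {A} {B} {B′} = Equivalence.from (monoʳ-<ₒ-⇔ B B′ A)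

    ⊕-monoʳ-≤ₒ : ∀ {A B B′} → B′ ≤ₒ B → (A ⊕ B′) ≤ₒ (A ⊕ B)
    ⊕-monoʳ-≤ₒ B′≤B with ≤ₒ⇒≅⊎<ₒ B′≤B
    ... | inj₁ B′≅B = ≅⇒≤ₒ (resp ≅ʳ-refl B′≅B)
    ... | inj₂ B′<B = proj₁ (⊕-monoʳ-<ₒ B′<B)

    ⊕-monoˡ-<ₒ : ∀ {A A′ B} → A′ <ₒ A → (A′ ⊕ B) <ₒ (A ⊕ B)
    ⊕-monoˡ-<ₒ {A} {A′} {B} A′<A =
      ≤ₒ-<ₒ-trans (≅⇒≤ₒ (comm A′ B)) (<ₒ-≤ₒ-trans (⊕-monoʳ-<ₒ A′<A) (≅⇒≤ₒ (comm B A)))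

    ⊕-monoˡ-≤ₒ : ∀ {A A′ B} → A′ ≤ₒ A → (A′ ⊕ B) ≤ₒ (A ⊕ B)
    ⊕-monoˡ-≤ₒ {A} {A′} {B} A′≤A =
      ≤ₒ-trans (≅⇒≤ₒ (comm A′ B)) (≤ₒ-trans (⊕-monoʳ-≤ₒ A′≤A) (≅⇒≤ₒ (comm B A)))

    ⊕-mono-<ₒ-≤ₒ : ∀ {A A′ B B′} → A′ <ₒ A → B′ ≤ₒ B → (A′ ⊕ B′) <ₒ (A ⊕ B)
    ⊕-mono-<ₒ-≤ₒ A′<A B′≤B = ≤ₒ-<ₒ-trans (⊕-monoʳ-≤ₒ B′≤B) (⊕-monoˡ-<ₒ A′<A)

    ⊕-mono-≤ₒ-<ₒ : ∀ {A A′ B B′} → A′ ≤ₒ A → B′ <ₒ B → (A′ ⊕ B′) <ₒ (A ⊕ B)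
    ⊕-mono-≤ₒ-<ₒ A′≤A B′<B = ≤ₒ-<ₒ-trans (⊕-monoˡ-≤ₒ A′≤A) (⊕-monoʳ-<ₒ B′<B)

    module _ (γ : Ordinal) (p : Ordinal.Carrier γ → Bool) where
      open Ordinal γ

      sumOfParts : (Carrier → Bool) → Ordinal
      sumOfParts D = (γ ↾ (D ∩ p)) ⊕ (γ ↾ (D ∩ (not ∘ p)))

      sumOfParts-<ₒ : ∀ {D c} → IsLowerSet γ D → T (D c) → sumOfParts (below γ c) <ₒ sumOfParts D
      sumOfParts-<ₒ {c = c} lower dc with T-or-T-not (p c)
      ... | inj₁ pc     =
        ⊕-mono-<ₒ-≤ₒ (below∩-<ₒ γ lower dc p pc) (below∩-≤ₒ γ lower dc (not ∘ p))
      ... | inj₂ not-pc =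
        ⊕-mono-≤ₒ-<ₒ (below∩-≤ₒ γ lower dc p) (below∩-<ₒ γ lower dc (not ∘ p) not-pc)

      lowerSet-≤ₒ-sumOfParts : ∀ {D} → IsLowerSet γ D →
                           (∀ {c} → T (D c) → γ ↾ below γ c ≤ₒ sumOfParts (below γ c)) →
                           γ ↾ D ≤ₒ sumOfParts D
      lowerSet-≤ₒ-sumOfParts lower ih =
        segments-<ₒ⇒≤ₒ γ lower (λ dc → ≤ₒ-<ₒ-trans (ih dc) (sumOfParts-<ₒ lower dc))

      segment-≤ₒ-sumOfParts : ∀ c → γ ↾ below γ c ≤ₒ sumOfParts (below γ c)
      segment-≤ₒ-sumOfParts c = go c (<-wf c)
        where
        go : ∀ c → Acc _<_ c → γ ↾ below γ c ≤ₒ sumOfParts (below γ c)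
        go c (acc rec) =
          lowerSet-≤ₒ-sumOfParts (below-isLowerSet γ) (λ c′<c → go _ (rec (below⇒< γ c′<c)))

      ≤ₒ-⊕-parts : γ ≤ₒ ((γ ↾ p) ⊕ (γ ↾ (not ∘ p)))
      ≤ₒ-⊕-parts = ≤ₒ-trans (≅⇒≤ₒ (↾-true-≅ γ))
                     (lowerSet-≤ₒ-sumOfParts (λ _ _ → tt) (λ {c} _ → segment-≤ₒ-sumOfParts c))

mainTheorem11 : ExcludedMiddle 0ℓ →
    (_⊕_ : Ordinal → Ordinal → Ordinal) → NaturalOp _⊕_ →
    (α β γ : Ordinal) →
    IsSumInstance (Ordinal.raw γ) (Ordinal.raw α) (Ordinal.raw β) →
    γ ≤ₒ (α ⊕ β)
mainTheorem11 em _⊕_ N α β γ (p , γ↾p≅α , γ↾¬p≅β) =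
  ≤ₒ-trans (≤ₒ-⊕-parts em N γ p)
    (≅⇒≤ₒ (resp (≅ʳ-trans (↾≅sub γ T-≡ ≡-irrelevant) γ↾p≅α)
                (≅ʳ-trans (↾≅sub γ T-not-≡ ≡-irrelevant) γ↾¬p≅β)))
  where
  open NaturalOp N using (resp)
  open Decidable⇒UIP _≟_ using (≡-irrelevant)
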